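{- For every $k\ge1$, the map $G\mapsto e_{G,k}(t_1,\dots,t_k)=\sum_{j_1,\dots,j_k\ge0}V_{j_1,\dots,j_k}(G)\,t_1^{j_1}\cdots t_k^{j_k}$ is a ring homomorphism from the strong ring to $\mathbb{Z}[t_1,\dots,t_k]$.
   Context: A finite abstract simplicial complex is a finite set of nonempty finite sets closed under taking nonempty subsets; $\dim(x)=|x|-1$. The Cartesian product $A_1\times\cdots\times A_m$ of complexes is the set of cells $(x_1,\dots,x_m)$, $x_i\in A_i$, of dimension $\sum_i\dim x_i$; two cells intersect iff they intersect componentwise. The strong ring consists of formal finite integer combinations (signed disjoint unions) of such products, with addition = disjoint union (cells in different summands never intersect; formal negatives allowed), multiplication = Cartesian product extended bilinearly, $0$ = empty complex, $1$ = one-point complex. For a product $G$, the $f$-tensor entry $V_{j_1,\dots,j_k}(G)$ is the number of ordered $k$-tuples $(c_1,\dots,c_k)$ of pairwise intersecting cells of $G$ with $\dim c_i=j_i$ for all $i$; it is extended additively (with signs) to the strong ring. -}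

module Defs where

open import Data.Bool using (Bool; true; false; _∧_; _∨_)
open import Data.Nat using (ℕ; zero; suc; _∸_; _≟_)
open import Data.Integer as ℤ using (ℤ; +_; 0ℤ; 1ℤ)
open import Data.Fin using (Fin; zero; suc)
open import Data.Fin.Subset using (Subset; Nonempty; _⊆_; ∣_∣; inside; outside)
open import Data.Vec using (Vec; []; _∷_; zipWith)
open import Data.List using (List; []; _∷_; [_]; map; concatMap; filter; filterᵇ; length; cartesianProduct; upTo; _++_; foldr)
open import Data.List.Relation.Unary.All using (All; []; _∷_)
open import Data.List.Relation.Unary.Any using (here)
open import Data.List.Relation.Unary.Unique.Propositional using (Unique)
open import Data.List.Relation.Unary.AllPairs using ([]; _∷_)
import Data.List.Membership.Propositional as LM
open import Data.Product using (_×_; _,_; Σ)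
open import Data.Unit using (⊤; tt)
open import Relation.Binary.PropositionalEquality using (_≡_; refl)

import Data.Vec.Base

-- Finite abstract simplicial complexes on a vertex set Fin n.
-- A cell is a subset of the vertices; the complex is a duplicate-free
-- list of nonempty cells closed under taking nonempty subsets.

record Complex : Set where
  field
    n        : ℕ
    cells    : List (Subset n)
    distinct : Unique cells
    nonempty : All Nonempty cells
    closed   : ∀ {x y : Subset n} → x LM.∈ cells → y ⊆ x → Nonempty y → y LM.∈ cells

open Complex public

dimS : ∀ {n} → Subset n → ℕ
dimS x = ∣ x ∣ ∸ 1

meetsS : ∀ {n} → Subset n → Subset n → Bool
meetsS []      []      = false
meetsS (a ∷ x) (b ∷ y) = (a ∧ b) ∨ meetsS x y

-- Cartesian products A₁ × ⋯ × Aₘ, given by the list of factors.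

Product : Set
Product = List Complex

PCell : Product → Set
PCell []       = ⊤
PCell (A ∷ As) = Subset (n A) × PCell As

pcells : (As : Product) → List (PCell As)
pcells []       = [ tt ]
pcells (A ∷ As) = cartesianProduct (cells A) (pcells As)

pdim : (As : Product) → PCell As → ℕ
pdim []       tt       = 0
pdim (A ∷ As) (x , c)  = dimS x Data.Nat.+ pdim As c

pmeets : (As : Product) → PCell As → PCell As → Bool
pmeets []       tt      tt      = true
pmeets (A ∷ As) (x , c) (y , d) = meetsS x y ∧ pmeets As c d

allMeet : (As : Product) → PCell As → ∀ {k} → Vec (PCell As) k → Bool
allMeet As c []       = true
allMeet As c (d ∷ ds) = pmeets As c d ∧ allMeet As c ds

pairwise : (As : Product) → ∀ {k} → Vec (PCell As) k → Bool
pairwise As []       = true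
pairwise As (c ∷ cs) = allMeet As c cs ∧ pairwise As cs

tuplesWithDims : (As : Product) → ∀ {k} → Vec ℕ k → List (Vec (PCell As) k)
tuplesWithDims As []       = [ [] ]
tuplesWithDims As (j ∷ js) =
  concatMap (λ c → map (c ∷_) (tuplesWithDims As js))
            (filter (λ c → pdim As c ≟ j) (pcells As))

V : (As : Product) → ∀ {k} → Vec ℕ k → ℕ
V As js = length (filterᵇ (pairwise As) (tuplesWithDims As js))

-- The strong ring: formal finite integer combinations of products.

SR : Set
SR = List (ℤ × Product)

_⊕_ : SR → SR → SR
G ⊕ H = G ++ H

⊖_ : SR → SR
⊖ G = map (λ { (a , P) → (ℤ.- a , P) }) G

_⊗_ : SR → SR → SR
G ⊗ H = concatMap (λ { (a , P) → map (λ { (b , Q) → (a ℤ.* b , P ++ Q) }) H }) G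

0SR : SR
0SR = []

ptComplex : Complex
ptComplex = record
  { n        = 1
  ; cells    = (true ∷ []) ∷ []
  ; distinct = [] ∷ []
  ; nonempty = (zero , Data.Vec.Base.here) ∷ []
  ; closed   = cl
  }
  where
  cl : ∀ {x y : Subset 1} → x LM.∈ ((true ∷ []) ∷ []) → y ⊆ x → Nonempty y → y LM.∈ ((true ∷ []) ∷ [])
  cl {y = true ∷ []}  _ _ _          = here refl
  cl {y = false ∷ []} _ _ (zero , ())

1SR : SR
1SR = [ (1ℤ , ptComplex ∷ []) ]

-- Polynomials in ℤ[t₁,…,t_k], as coefficient functions on exponent
-- vectors (j₁,…,j_k).  Equality is pointwise equality of coefficients.

Poly : ℕ → Set
Poly k = Vec ℕ k → ℤ

below : ∀ {k} → Vec ℕ k → List (Vec ℕ k)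
below []       = [ [] ]
below (j ∷ js) = concatMap (λ a → map (a ∷_) (below js)) (upTo (suc j))

sumℤ : List ℤ → ℤ
sumℤ = foldr ℤ._+_ 0ℤ

polyMul : ∀ {k} → Poly k → Poly k → Poly k
polyMul P Q js = sumℤ (map (λ a → P a ℤ.* Q (zipWith _∸_ js a)) (below js))

polyOne : ∀ {k} → Poly k
polyOne []            = 1ℤ
polyOne (zero ∷ js)   = polyOne js
polyOne (suc _ ∷ js)  = 0ℤ

totalDeg : ∀ {k} → Vec ℕ k → ℕ
totalDeg []       = 0
totalDeg (j ∷ js) = j Data.Nat.+ totalDeg js

eCoeff : (k : ℕ) → SR → Poly k
eCoeff k G js = sumℤ (map (λ { (a , P) → a ℤ.* (+ V P js) }) G)

-- A k-tuple of cells of a product P × Q is a pair of k-tuples of cells of P and of Q;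
-- dimensions add and cells meet iff both components meet, so the tuples of P × Q
-- with dimension vector j that pairwise meet are counted by the convolution
-- Σ_{α ≤ j} V_α(P) · V_{j-α}(Q).  Hence e_{P×Q} = e_P · e_Q, and the rest of the
-- ring structure follows by linearity; the point has one cell, of dimension 0.
module Submission where

open import Level using (Level)
open import Function using (_∘_)
open import Algebra.Bundles using (CommutativeSemiring; CommutativeMonoid)
import Algebra.Properties.CommutativeSemigroup as CommSemigroupProperties
import Relation.Binary.Reasoning.Setoid as SetoidReasoning
open import Data.Bool using (Bool; true; false; _∧_)
open import Data.List
  using (List; []; _∷_; map; _++_; filter; filterᵇ; length; concatMap; cartesianProduct; applyUpTo; upTo)
open import Data.Product using (_,_)
open import Relation.Nullary using (Dec; does)

private
  variable
    a : Level
    A B C D : Set a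

module ListSum {c ℓ} (R : CommutativeSemiring c ℓ) where

  open CommutativeSemiring R
  open CommSemigroupProperties +-commutativeSemigroup using () renaming (interchange to +-interchange)
  open SetoidReasoning setoid

  ∑ : List A → (A → Carrier) → Carrier
  ∑ []       f = 0#
  ∑ (x ∷ xs) f = f x + ∑ xs f

  infix 5 ∑
  syntax ∑ xs (λ x → e) = ∑[ x ∈ xs ] e

  𝟙 : Bool → Carrier
  𝟙 true  = 1#
  𝟙 false = 0#

  𝟙-∧ : ∀ p q → 𝟙 (p ∧ q) ≈ 𝟙 p * 𝟙 q
  𝟙-∧ true  q = sym (*-identityˡ (𝟙 q))
  𝟙-∧ false q = sym (zeroˡ (𝟙 q))

  ∑-cong : ∀ (xs : List A) {f g : A → Carrier} → (∀ x → f x ≈ g x) → ∑ xs f ≈ ∑ xs g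
  ∑-cong []       f≈g = refl
  ∑-cong (x ∷ xs) f≈g = +-cong (f≈g x) (∑-cong xs f≈g)

  ∑-zero : ∀ (xs : List A) → ∑[ x ∈ xs ] 0# ≈ 0#
  ∑-zero []       = refl
  ∑-zero (x ∷ xs) = trans (+-identityˡ _) (∑-zero xs)

  ∑-++ : ∀ (xs ys : List A) f → ∑ (xs ++ ys) f ≈ ∑ xs f + ∑ ys f
  ∑-++ []       ys f = sym (+-identityˡ _)
  ∑-++ (x ∷ xs) ys f = trans (+-congˡ (∑-++ xs ys f)) (sym (+-assoc _ _ _))

  ∑-map : ∀ (g : A → B) (xs : List A) f → ∑ (map g xs) f ≈ ∑ xs (f ∘ g)
  ∑-map g []       f = refl
  ∑-map g (x ∷ xs) f = +-congˡ (∑-map g xs f)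

  ∑-concatMap : ∀ (g : A → List B) (xs : List A) f →
                ∑ (concatMap g xs) f ≈ ∑[ x ∈ xs ] ∑ (g x) f
  ∑-concatMap g []       f = refl
  ∑-concatMap g (x ∷ xs) f = trans (∑-++ (g x) _ f) (+-congˡ (∑-concatMap g xs f))

  ∑-cartesianProduct : ∀ (xs : List A) (ys : List B) f →
                       ∑ (cartesianProduct xs ys) f ≈ ∑[ x ∈ xs ] ∑[ y ∈ ys ] f (x , y)
  ∑-cartesianProduct []       ys f = refl
  ∑-cartesianProduct (x ∷ xs) ys f =
    trans (∑-++ (map (x ,_) ys) _ f) (+-cong (∑-map (x ,_) ys f) (∑-cartesianProduct xs ys f))

  ∑-filter : ∀ {P : A → Set a} (P? : ∀ x → Dec (P x)) (xs : List A) f →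
             ∑ (filter P? xs) f ≈ ∑[ x ∈ xs ] 𝟙 (does (P? x)) * f x
  ∑-filter P? []       f = refl
  ∑-filter P? (x ∷ xs) f with does (P? x)
  ... | true  = +-cong (sym (*-identityˡ (f x))) (∑-filter P? xs f)
  ... | false = trans (∑-filter P? xs f) (sym (trans (+-congʳ (zeroˡ (f x))) (+-identityˡ _)))

  ∑-+ : ∀ (xs : List A) f g → ∑[ x ∈ xs ] (f x + g x) ≈ ∑ xs f + ∑ xs g
  ∑-+ []       f g = sym (+-identityˡ 0#)
  ∑-+ (x ∷ xs) f g = trans (+-congˡ (∑-+ xs f g)) (+-interchange _ _ _ _)

  ∑-*ˡ : ∀ (xs : List A) c f → c * ∑ xs f ≈ ∑[ x ∈ xs ] c * f x
  ∑-*ˡ []       c f = zeroʳ c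
  ∑-*ˡ (x ∷ xs) c f = trans (distribˡ c _ _) (+-congˡ (∑-*ˡ xs c f))

  ∑-*ʳ : ∀ (xs : List A) c f → ∑ xs f * c ≈ ∑[ x ∈ xs ] f x * c
  ∑-*ʳ []       c f = zeroˡ c
  ∑-*ʳ (x ∷ xs) c f = trans (distribʳ c _ _) (+-congˡ (∑-*ʳ xs c f))

  ∑-*-∑ : ∀ (xs : List A) (ys : List B) f g →
          ∑ xs f * ∑ ys g ≈ ∑[ x ∈ xs ] ∑[ y ∈ ys ] f x * g y
  ∑-*-∑ xs ys f g = trans (∑-*ʳ xs _ f) (∑-cong xs (λ x → ∑-*ˡ ys (f x) g))

  ∑-swap : ∀ (xs : List A) (ys : List B) (f : A → B → Carrier) →
           ∑[ x ∈ xs ] ∑[ y ∈ ys ] f x y ≈ ∑[ y ∈ ys ] ∑[ x ∈ xs ] f x y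
  ∑-swap []       ys f = sym (∑-zero ys)
  ∑-swap (x ∷ xs) ys f =
    trans (+-congˡ (∑-swap xs ys f)) (sym (∑-+ ys (f x) (λ y → ∑[ x′ ∈ xs ] f x′ y)))

  ∑∑-swap : ∀ (xs : List A) (ys : List B) (zs : List C) (ws : List D)
              (f : A → B → C → D → Carrier) →
            ∑[ x ∈ xs ] ∑[ y ∈ ys ] ∑[ z ∈ zs ] ∑[ w ∈ ws ] f x y z w ≈
            ∑[ z ∈ zs ] ∑[ w ∈ ws ] ∑[ x ∈ xs ] ∑[ y ∈ ys ] f x y z w
  ∑∑-swap xs ys zs ws f = begin
    ∑[ x ∈ xs ] ∑[ y ∈ ys ] ∑[ z ∈ zs ] ∑[ w ∈ ws ] f x y z w
      ≈⟨ ∑-cong xs (λ x → ∑-swap ys zs (λ y z → ∑[ w ∈ ws ] f x y z w)) ⟩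
    ∑[ x ∈ xs ] ∑[ z ∈ zs ] ∑[ y ∈ ys ] ∑[ w ∈ ws ] f x y z w
      ≈⟨ ∑-cong xs (λ x → ∑-cong zs (λ z → ∑-swap ys ws (λ y w → f x y z w))) ⟩
    ∑[ x ∈ xs ] ∑[ z ∈ zs ] ∑[ w ∈ ws ] ∑[ y ∈ ys ] f x y z w
      ≈⟨ ∑-swap xs zs (λ x z → ∑[ w ∈ ws ] ∑[ y ∈ ys ] f x y z w) ⟩
    ∑[ z ∈ zs ] ∑[ x ∈ xs ] ∑[ w ∈ ws ] ∑[ y ∈ ys ] f x y z w
      ≈⟨ ∑-cong zs (λ z → ∑-swap xs ws (λ x w → ∑[ y ∈ ys ] f x y z w)) ⟩
    ∑[ z ∈ zs ] ∑[ w ∈ ws ] ∑[ x ∈ xs ] ∑[ y ∈ ys ] f x y z w ∎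

open import Defs
open import Data.Nat using (ℕ; _≤_; _<_)
open import Data.Integer using (0ℤ; _+_; -_)
open import Data.Vec using (Vec)
open import Data.Product using (_×_; ∃-syntax)
open import Relation.Binary.PropositionalEquality using (_≡_)

import Data.Bool.Properties as Boolₚ
open import Data.Nat as ℕ using (zero; suc; _*_; _∸_; _≡ᵇ_; _⊔_; z≤n; s≤s; _<?_)
import Data.Nat.Properties as ℕₚ
open import Data.Integer as ℤ using (ℤ; +_; 1ℤ)
import Data.Integer.Properties as ℤₚ
open import Data.List.Properties using (map-upTo)
open import Data.Vec using ([]; _∷_; zipWith; replicate)
open import Data.Vec.Relation.Unary.Any as Any using (Any; here; there)
open import Data.Unit using (tt)
open import Data.Fin.Subset using (∣_∣)
open import Data.Fin.Subset.Properties using (∣p∣≤n)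
open import Relation.Binary.PropositionalEquality using (refl; sym; trans; cong; cong₂; module ≡-Reasoning)
open import Relation.Nullary using (yes; no)

open CommSemigroupProperties ℕₚ.*-commutativeSemigroup using () renaming (interchange to ℕ*-interchange)
open CommSemigroupProperties ℤₚ.*-commutativeSemigroup using () renaming (interchange to ℤ*-interchange)
open CommSemigroupProperties (CommutativeMonoid.commutativeSemigroup Boolₚ.∧-commutativeMonoid)
  using () renaming (interchange to ∧-interchange)

open ListSum ℕₚ.+-*-commutativeSemiring
module ℤ∑ = ListSum ℤₚ.+-*-commutativeSemiring

length-filterᵇ : ∀ (p : A → Bool) xs → length (filterᵇ p xs) ≡ ∑[ x ∈ xs ] 𝟙 (p x)
length-filterᵇ p []       = refl
length-filterᵇ p (x ∷ xs) with p x
... | true  = cong suc (length-filterᵇ p xs)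
... | false = length-filterᵇ p xs

∑-applyUpTo-suc : ∀ n (f : ℕ → ℕ) → ∑[ i ∈ applyUpTo suc n ] f i ≡ ∑[ i ∈ upTo n ] f (suc i)
∑-applyUpTo-suc n f = trans (cong (λ is → ∑ is f) (sym (map-upTo suc n))) (∑-map suc (upTo n) f)

∑-upTo-split : ∀ m n j → ∑[ a ∈ upTo (suc j) ] 𝟙 (m ≡ᵇ a) * 𝟙 (n ≡ᵇ j ∸ a) ≡ 𝟙 (m ℕ.+ n ≡ᵇ j)
∑-upTo-split zero    n j       = begin
  𝟙 (n ≡ᵇ j) ℕ.+ 0 ℕ.+ (∑[ a ∈ applyUpTo suc j ] 𝟙 (0 ≡ᵇ a) * 𝟙 (n ≡ᵇ j ∸ a))
    ≡⟨ cong₂ ℕ._+_ (ℕₚ.+-identityʳ _) (∑-applyUpTo-suc j (λ a → 𝟙 (0 ≡ᵇ a) * 𝟙 (n ≡ᵇ j ∸ a))) ⟩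
  𝟙 (n ≡ᵇ j) ℕ.+ (∑[ a ∈ upTo j ] 0)
    ≡⟨ cong (𝟙 (n ≡ᵇ j) ℕ.+_) (∑-zero (upTo j)) ⟩
  𝟙 (n ≡ᵇ j) ℕ.+ 0
    ≡⟨ ℕₚ.+-identityʳ _ ⟩
  𝟙 (n ≡ᵇ j) ∎
  where open ≡-Reasoning
∑-upTo-split (suc m) n zero    = refl
∑-upTo-split (suc m) n (suc j) =
  trans (∑-applyUpTo-suc (suc j) (λ a → 𝟙 (suc m ≡ᵇ a) * 𝟙 (n ≡ᵇ suc j ∸ a))) (∑-upTo-split m n j)

joinCell : ∀ P Q → PCell P → PCell Q → PCell (P ++ Q)
joinCell []      Q tt      y = y
joinCell (A ∷ P) Q (x , c) y = x , joinCell P Q c y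

∑-pcells-++ : ∀ P Q (f : PCell (P ++ Q) → ℕ) →
              ∑[ c ∈ pcells (P ++ Q) ] f c ≡ ∑[ x ∈ pcells P ] ∑[ y ∈ pcells Q ] f (joinCell P Q x y)
∑-pcells-++ []      Q f = sym (ℕₚ.+-identityʳ _)
∑-pcells-++ (A ∷ P) Q f = begin
  ∑[ c ∈ cartesianProduct (cells A) (pcells (P ++ Q)) ] f c
    ≡⟨ ∑-cartesianProduct (cells A) (pcells (P ++ Q)) f ⟩
  ∑[ a ∈ cells A ] ∑[ c ∈ pcells (P ++ Q) ] f (a , c)
    ≡⟨ ∑-cong (cells A) (λ a → ∑-pcells-++ P Q (λ c → f (a , c))) ⟩
  ∑[ a ∈ cells A ] ∑[ x ∈ pcells P ] ∑[ y ∈ pcells Q ] f (a , joinCell P Q x y)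
    ≡⟨ sym (∑-cartesianProduct (cells A) (pcells P)
                               (λ (a , x) → ∑[ y ∈ pcells Q ] f (a , joinCell P Q x y))) ⟩
  ∑[ x ∈ pcells (A ∷ P) ] ∑[ y ∈ pcells Q ] f (joinCell (A ∷ P) Q x y) ∎
  where open ≡-Reasoning

pdim-joinCell : ∀ P Q x y → pdim (P ++ Q) (joinCell P Q x y) ≡ pdim P x ℕ.+ pdim Q y
pdim-joinCell []      Q tt      y = refl
pdim-joinCell (A ∷ P) Q (a , c) y =
  trans (cong (dimS a ℕ.+_) (pdim-joinCell P Q c y)) (sym (ℕₚ.+-assoc (dimS a) _ _))

pmeets-joinCell : ∀ P Q x y x′ y′ →
                  pmeets (P ++ Q) (joinCell P Q x y) (joinCell P Q x′ y′) ≡ pmeets P x x′ ∧ pmeets Q y y′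
pmeets-joinCell []      Q tt      y tt        y′ = refl
pmeets-joinCell (A ∷ P) Q (a , c) y (a′ , c′) y′ =
  trans (cong (meetsS a a′ ∧_) (pmeets-joinCell P Q c y c′ y′)) (sym (Boolₚ.∧-assoc (meetsS a a′) _ _))

allMeet-joinCell : ∀ P Q x y {k} (u : Vec (PCell P) k) (v : Vec (PCell Q) k) →
                   allMeet (P ++ Q) (joinCell P Q x y) (zipWith (joinCell P Q) u v) ≡
                   allMeet P x u ∧ allMeet Q y v
allMeet-joinCell P Q x y []       []       = refl
allMeet-joinCell P Q x y (x′ ∷ u) (y′ ∷ v) =
  trans (cong₂ _∧_ (pmeets-joinCell P Q x y x′ y′) (allMeet-joinCell P Q x y u v))
        (∧-interchange (pmeets P x x′) (pmeets Q y y′) (allMeet P x u) (allMeet Q y v))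

pairwise-joinCell : ∀ P Q {k} (u : Vec (PCell P) k) (v : Vec (PCell Q) k) →
                    pairwise (P ++ Q) (zipWith (joinCell P Q) u v) ≡ pairwise P u ∧ pairwise Q v
pairwise-joinCell P Q []      []      = refl
pairwise-joinCell P Q (x ∷ u) (y ∷ v) =
  trans (cong₂ _∧_ (allMeet-joinCell P Q x y u v) (pairwise-joinCell P Q u v))
        (∧-interchange (allMeet P x u) (allMeet Q y v) (pairwise P u) (pairwise Q v))

∑-tuplesWithDims-∷ : ∀ As {k} j (js : Vec ℕ k) (f : Vec (PCell As) (suc k) → ℕ) →
                     ∑[ t ∈ tuplesWithDims As (j ∷ js) ] f t ≡
                     ∑[ c ∈ pcells As ] 𝟙 (pdim As c ≡ᵇ j) * (∑[ t ∈ tuplesWithDims As js ] f (c ∷ t))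
∑-tuplesWithDims-∷ As j js f = begin
  ∑[ t ∈ concatMap (λ c → map (c ∷_) (T js)) cellsOfDim ] f t
    ≡⟨ ∑-concatMap (λ c → map (c ∷_) (T js)) cellsOfDim f ⟩
  ∑[ c ∈ cellsOfDim ] ∑[ t ∈ map (c ∷_) (T js) ] f t
    ≡⟨ ∑-cong cellsOfDim (λ c → ∑-map (c ∷_) (T js) f) ⟩
  ∑[ c ∈ cellsOfDim ] ∑[ t ∈ T js ] f (c ∷ t)
    ≡⟨ ∑-filter (λ c → pdim As c ℕ.≟ j) (pcells As) (λ c → ∑[ t ∈ T js ] f (c ∷ t)) ⟩
  ∑[ c ∈ pcells As ] 𝟙 (pdim As c ≡ᵇ j) * (∑[ t ∈ T js ] f (c ∷ t)) ∎
  where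
  open ≡-Reasoning
  T = tuplesWithDims As
  cellsOfDim = filter (λ c → pdim As c ℕ.≟ j) (pcells As)

∑-below-∷ : ∀ {k} j (js : Vec ℕ k) (g : Vec ℕ (suc k) → ℕ) →
            ∑[ α ∈ below (j ∷ js) ] g α ≡ ∑[ a ∈ upTo (suc j) ] ∑[ α ∈ below js ] g (a ∷ α)
∑-below-∷ j js g =
  trans (∑-concatMap (λ a → map (a ∷_) (below js)) (upTo (suc j)) g)
        (∑-cong (upTo (suc j)) (λ a → ∑-map (a ∷_) (below js) g))

∑-tuplesWithDims-++ : ∀ P Q {k} (js : Vec ℕ k) (f : Vec (PCell (P ++ Q)) k → ℕ)
                      (g : Vec (PCell P) k → ℕ) (h : Vec (PCell Q) k → ℕ) →
                      (∀ u v → f (zipWith (joinCell P Q) u v) ≡ g u * h v) →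
                      ∑[ t ∈ tuplesWithDims (P ++ Q) js ] f t ≡
                      ∑[ α ∈ below js ] (∑[ u ∈ tuplesWithDims P α ] g u) *
                                        (∑[ v ∈ tuplesWithDims Q (zipWith _∸_ js α) ] h v)
∑-tuplesWithDims-++ P Q []       f g h f≡gh =
  trans (ℕₚ.+-identityʳ (f [])) (trans (f≡gh [] [])
    (sym (trans (ℕₚ.+-identityʳ _) (cong₂ _*_ (ℕₚ.+-identityʳ (g [])) (ℕₚ.+-identityʳ (h []))))))
∑-tuplesWithDims-++ P Q (j ∷ js) f g h f≡gh = begin
  ∑[ t ∈ T (P ++ Q) (j ∷ js) ] f t
    ≡⟨ ∑-tuplesWithDims-∷ (P ++ Q) j js f ⟩
  ∑[ c ∈ pcells (P ++ Q) ] 𝟙 (pdim (P ++ Q) c ≡ᵇ j) * (∑[ t ∈ T (P ++ Q) js ] f (c ∷ t))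
    ≡⟨ ∑-pcells-++ P Q _ ⟩
  ∑[ x ∈ pcells P ] ∑[ y ∈ pcells Q ]
    𝟙 (pdim (P ++ Q) (joinCell P Q x y) ≡ᵇ j) * (∑[ t ∈ T (P ++ Q) js ] f (joinCell P Q x y ∷ t))
    ≡⟨ ∑-cong (pcells P) (λ x → ∑-cong (pcells Q) (λ y → cong₂ _*_
         (cong (λ d → 𝟙 (d ≡ᵇ j)) (pdim-joinCell P Q x y))
         (∑-tuplesWithDims-++ P Q js _ (g ∘ (x ∷_)) (h ∘ (y ∷_)) (λ u v → f≡gh (x ∷ u) (y ∷ v))))) ⟩
  ∑[ x ∈ pcells P ] ∑[ y ∈ pcells Q ] 𝟙 (pdim P x ℕ.+ pdim Q y ≡ᵇ j) * (∑[ α ∈ below js ] G x α * H y α)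
    ≡⟨ ∑-cong (pcells P) (λ x → ∑-cong (pcells Q) (λ y → split x y)) ⟩
  ∑[ x ∈ pcells P ] ∑[ y ∈ pcells Q ] ∑[ a ∈ upTo (suc j) ] ∑[ α ∈ below js ] summand a α x y
    ≡⟨ ∑∑-swap (pcells P) (pcells Q) (upTo (suc j)) (below js) (λ x y a α → summand a α x y) ⟩
  ∑[ a ∈ upTo (suc j) ] ∑[ α ∈ below js ] ∑[ x ∈ pcells P ] ∑[ y ∈ pcells Q ] summand a α x y
    ≡⟨ ∑-cong (upTo (suc j)) (λ a → ∑-cong (below js) (λ α → factor a α)) ⟩
  ∑[ a ∈ upTo (suc j) ] ∑[ α ∈ below js ]
    (∑[ u ∈ T P (a ∷ α) ] g u) * (∑[ v ∈ T Q (j ∸ a ∷ zipWith _∸_ js α) ] h v)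
    ≡⟨ sym (∑-below-∷ j js _) ⟩
  ∑[ α ∈ below (j ∷ js) ] (∑[ u ∈ T P α ] g u) * (∑[ v ∈ T Q (zipWith _∸_ (j ∷ js) α) ] h v) ∎
  where
  open ≡-Reasoning
  T = tuplesWithDims

  G : PCell P → Vec ℕ _ → ℕ
  G x α = ∑[ u ∈ T P α ] g (x ∷ u)

  H : PCell Q → Vec ℕ _ → ℕ
  H y α = ∑[ v ∈ T Q (zipWith _∸_ js α) ] h (y ∷ v)

  summand : ℕ → Vec ℕ _ → PCell P → PCell Q → ℕ
  summand a α x y = (𝟙 (pdim P x ≡ᵇ a) * 𝟙 (pdim Q y ≡ᵇ j ∸ a)) * (G x α * H y α)

  split : ∀ x y → 𝟙 (pdim P x ℕ.+ pdim Q y ≡ᵇ j) * (∑[ α ∈ below js ] G x α * H y α) ≡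
                  ∑[ a ∈ upTo (suc j) ] ∑[ α ∈ below js ] summand a α x y
  split x y =
    trans (cong (_* (∑[ α ∈ below js ] G x α * H y α)) (sym (∑-upTo-split (pdim P x) (pdim Q y) j)))
    (trans (∑-*ʳ (upTo (suc j)) _ (λ a → 𝟙 (pdim P x ≡ᵇ a) * 𝟙 (pdim Q y ≡ᵇ j ∸ a)))
           (∑-cong (upTo (suc j)) (λ a →
             ∑-*ˡ (below js) (𝟙 (pdim P x ≡ᵇ a) * 𝟙 (pdim Q y ≡ᵇ j ∸ a)) (λ α → G x α * H y α))))

  factor : ∀ a α → ∑[ x ∈ pcells P ] ∑[ y ∈ pcells Q ] summand a α x y ≡
                   (∑[ u ∈ T P (a ∷ α) ] g u) * (∑[ v ∈ T Q (j ∸ a ∷ zipWith _∸_ js α) ] h v)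
  factor a α = begin
    ∑[ x ∈ pcells P ] ∑[ y ∈ pcells Q ] summand a α x y
      ≡⟨ ∑-cong (pcells P) (λ x → ∑-cong (pcells Q) (λ y →
           ℕ*-interchange (𝟙 (pdim P x ≡ᵇ a)) (𝟙 (pdim Q y ≡ᵇ j ∸ a)) (G x α) (H y α))) ⟩
    ∑[ x ∈ pcells P ] ∑[ y ∈ pcells Q ] (𝟙 (pdim P x ≡ᵇ a) * G x α) * (𝟙 (pdim Q y ≡ᵇ j ∸ a) * H y α)
      ≡⟨ sym (∑-*-∑ (pcells P) (pcells Q) _ _) ⟩
    (∑[ x ∈ pcells P ] 𝟙 (pdim P x ≡ᵇ a) * G x α) * (∑[ y ∈ pcells Q ] 𝟙 (pdim Q y ≡ᵇ j ∸ a) * H y α)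
      ≡⟨ sym (cong₂ _*_ (∑-tuplesWithDims-∷ P a α g) (∑-tuplesWithDims-∷ Q (j ∸ a) (zipWith _∸_ js α) h)) ⟩
    (∑[ u ∈ T P (a ∷ α) ] g u) * (∑[ v ∈ T Q (j ∸ a ∷ zipWith _∸_ js α) ] h v) ∎

V-∑ : ∀ As {k} (js : Vec ℕ k) → V As js ≡ ∑[ t ∈ tuplesWithDims As js ] 𝟙 (pairwise As t)
V-∑ As js = length-filterᵇ (pairwise As) (tuplesWithDims As js)

V-++ : ∀ P Q {k} (js : Vec ℕ k) → V (P ++ Q) js ≡ ∑[ α ∈ below js ] V P α * V Q (zipWith _∸_ js α)
V-++ P Q js =
  trans (V-∑ (P ++ Q) js)
  (trans (∑-tuplesWithDims-++ P Q js _ (𝟙 ∘ pairwise P) (𝟙 ∘ pairwise Q)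
            (λ u v → trans (cong 𝟙 (pairwise-joinCell P Q u v)) (𝟙-∧ (pairwise P u) (pairwise Q v))))
         (sym (∑-cong (below js) (λ α → cong₂ _*_ (V-∑ P α) (V-∑ Q (zipWith _∸_ js α))))))

point : PCell (ptComplex ∷ [])
point = (true ∷ []) , tt

allMeet-point : ∀ k → allMeet (ptComplex ∷ []) point (replicate k point) ≡ true
allMeet-point zero    = refl
allMeet-point (suc k) = allMeet-point k

pairwise-point : ∀ k → pairwise (ptComplex ∷ []) (replicate k point) ≡ true
pairwise-point zero    = refl
pairwise-point (suc k) = cong₂ _∧_ (allMeet-point k) (pairwise-point k)

∑-tuplesWithDims-point : ∀ {k} (js : Vec ℕ k) (f : Vec (PCell (ptComplex ∷ [])) k → ℕ) →
                         + (∑[ t ∈ tuplesWithDims (ptComplex ∷ []) js ] f t) ≡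
                         polyOne js ℤ.* + f (replicate k point)
∑-tuplesWithDims-point []           f = trans (cong +_ (ℕₚ.+-identityʳ (f []))) (sym (ℤₚ.*-identityˡ _))
∑-tuplesWithDims-point (zero  ∷ js) f =
  trans (cong +_ (trans (∑-tuplesWithDims-∷ (ptComplex ∷ []) zero js f)
                        (trans (ℕₚ.+-identityʳ _) (ℕₚ.*-identityˡ _))))
        (∑-tuplesWithDims-point js (f ∘ (point ∷_)))
∑-tuplesWithDims-point {suc k} (suc j ∷ js) f = sym (ℤₚ.*-zeroˡ (+ f (replicate (suc k) point)))

V-point : ∀ {k} (js : Vec ℕ k) → + V (ptComplex ∷ []) js ≡ polyOne js
V-point {k} js = begin
  + V (ptComplex ∷ []) js
    ≡⟨ cong +_ (V-∑ (ptComplex ∷ []) js) ⟩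
  + (∑[ t ∈ tuplesWithDims (ptComplex ∷ []) js ] 𝟙 (pairwise (ptComplex ∷ []) t))
    ≡⟨ ∑-tuplesWithDims-point js (𝟙 ∘ pairwise (ptComplex ∷ [])) ⟩
  polyOne js ℤ.* + 𝟙 (pairwise (ptComplex ∷ []) (replicate k point))
    ≡⟨ cong (λ b → polyOne js ℤ.* + 𝟙 b) (pairwise-point k) ⟩
  polyOne js ℤ.* 1ℤ
    ≡⟨ ℤₚ.*-identityʳ (polyOne js) ⟩
  polyOne js ∎
  where open ≡-Reasoning

dimBound : Product → ℕ
dimBound []       = 0
dimBound (A ∷ As) = n A ℕ.+ dimBound As

pdim≤dimBound : ∀ As (c : PCell As) → pdim As c ≤ dimBound As
pdim≤dimBound []       tt      = z≤n
pdim≤dimBound (A ∷ As) (x , c) =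
  ℕₚ.+-mono-≤ (ℕₚ.≤-trans (ℕₚ.m∸n≤m ∣ x ∣ 1) (∣p∣≤n x)) (pdim≤dimBound As c)

<⇒≡ᵇ≡false : ∀ {m n} → m < n → (m ≡ᵇ n) ≡ false
<⇒≡ᵇ≡false {zero}  {suc n} _          = refl
<⇒≡ᵇ≡false {suc m} {suc n} (s≤s m<n) = <⇒≡ᵇ≡false m<n

∑-tuplesWithDims-tooLarge : ∀ As {k} (js : Vec ℕ k) (f : Vec (PCell As) k → ℕ) →
                            Any (dimBound As <_) js → ∑[ t ∈ tuplesWithDims As js ] f t ≡ 0
∑-tuplesWithDims-tooLarge As (j ∷ js) f (here bound<j) =
  trans (∑-tuplesWithDims-∷ As j js f)
  (trans (∑-cong (pcells As) (λ c → cong (λ b → 𝟙 b * (∑[ t ∈ tuplesWithDims As js ] f (c ∷ t)))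
                                        (<⇒≡ᵇ≡false (ℕₚ.≤-<-trans (pdim≤dimBound As c) bound<j))))
         (∑-zero (pcells As)))
∑-tuplesWithDims-tooLarge As (j ∷ js) f (there large) =
  trans (∑-tuplesWithDims-∷ As j js f)
  (trans (∑-cong (pcells As) (λ c → trans (cong (𝟙 (pdim As c ≡ᵇ j) *_)
                                                 (∑-tuplesWithDims-tooLarge As js (f ∘ (c ∷_)) large))
                                          (ℕₚ.*-zeroʳ (𝟙 (pdim As c ≡ᵇ j)))))
         (∑-zero (pcells As)))

V-tooLarge : ∀ As {k} (js : Vec ℕ k) → Any (dimBound As <_) js → V As js ≡ 0
V-tooLarge As js large = trans (V-∑ As js) (∑-tuplesWithDims-tooLarge As js _ large)

<totalDeg⇒Any< : ∀ d {k} (js : Vec ℕ k) → k * d < totalDeg js → Any (d <_) js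
<totalDeg⇒Any< d (j ∷ js) kd<deg with d <? j
... | yes d<j = here d<j
... | no  d≮j = there (<totalDeg⇒Any< d js
  (ℕₚ.+-cancelˡ-< d _ _ (ℕₚ.<-≤-trans kd<deg (ℕₚ.+-monoˡ-≤ (totalDeg js) (ℕₚ.≮⇒≥ d≮j)))))

+-∑ : ∀ (xs : List A) (f : A → ℕ) → + (∑[ x ∈ xs ] f x) ≡ ℤ∑.∑[ x ∈ xs ] + f x
+-∑ []       f = refl
+-∑ (x ∷ xs) f = trans (ℤₚ.pos-+ (f x) _) (cong (_+_ (+ f x)) (+-∑ xs f))

sumℤ-map : ∀ (xs : List A) (f : A → ℤ) → sumℤ (map f xs) ≡ ℤ∑.∑[ x ∈ xs ] f x
sumℤ-map []       f = refl
sumℤ-map (x ∷ xs) f = cong (_+_ (f x)) (sumℤ-map xs f)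

polyMul-∑ : ∀ {k} (p q : Poly k) js →
            polyMul p q js ≡ ℤ∑.∑[ α ∈ below js ] p α ℤ.* q (zipWith _∸_ js α)
polyMul-∑ p q js = sumℤ-map (below js) _

coeff : ∀ {k} → Vec ℕ k → ℤ × Product → ℤ
coeff js (a , P) = a ℤ.* + V P js

eCoeff-∑ : ∀ k (G : SR) js → eCoeff k G js ≡ ℤ∑.∑[ x ∈ G ] coeff js x
eCoeff-∑ k G js = sumℤ-map G _

coeff-++ : ∀ {k} (js : Vec ℕ k) a b P Q →
           coeff js (a ℤ.* b , P ++ Q) ≡
           ℤ∑.∑[ α ∈ below js ] coeff α (a , P) ℤ.* coeff (zipWith _∸_ js α) (b , Q)
coeff-++ js a b P Q = begin
  (a ℤ.* b) ℤ.* + V (P ++ Q) js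
    ≡⟨ cong (λ v → (a ℤ.* b) ℤ.* + v) (V-++ P Q js) ⟩
  (a ℤ.* b) ℤ.* + (∑[ α ∈ below js ] V P α * V Q (js′ α))
    ≡⟨ cong ((a ℤ.* b) ℤ.*_) (trans (+-∑ (below js) _) (ℤ∑.∑-cong (below js) (λ α → ℤₚ.pos-* (V P α) _))) ⟩
  (a ℤ.* b) ℤ.* (ℤ∑.∑[ α ∈ below js ] + V P α ℤ.* + V Q (js′ α))
    ≡⟨ ℤ∑.∑-*ˡ (below js) (a ℤ.* b) _ ⟩
  ℤ∑.∑[ α ∈ below js ] (a ℤ.* b) ℤ.* (+ V P α ℤ.* + V Q (js′ α))
    ≡⟨ ℤ∑.∑-cong (below js) (λ α → ℤ*-interchange a b (+ V P α) (+ V Q (js′ α))) ⟩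
  ℤ∑.∑[ α ∈ below js ] (a ℤ.* + V P α) ℤ.* (b ℤ.* + V Q (js′ α)) ∎
  where
  open ≡-Reasoning
  js′ = zipWith _∸_ js

module _ (k : ℕ) where

  eCoeff-⊕ : ∀ (G H : SR) (js : Vec ℕ k) → eCoeff k (G ⊕ H) js ≡ eCoeff k G js + eCoeff k H js
  eCoeff-⊕ G H js =
    trans (eCoeff-∑ k (G ++ H) js)
    (trans (ℤ∑.∑-++ G H (coeff js)) (sym (cong₂ _+_ (eCoeff-∑ k G js) (eCoeff-∑ k H js))))

  eCoeff-⊖ : ∀ (G : SR) (js : Vec ℕ k) → eCoeff k (⊖ G) js ≡ - eCoeff k G js
  eCoeff-⊖ []            js = refl
  eCoeff-⊖ ((a , P) ∷ G) js =
    trans (cong₂ _+_ (sym (ℤₚ.neg-distribˡ-* a (+ V P js))) (eCoeff-⊖ G js))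
          (sym (ℤₚ.neg-distrib-+ (coeff js (a , P)) (eCoeff k G js)))

  eCoeff-⊗ : ∀ (G H : SR) (js : Vec ℕ k) → eCoeff k (G ⊗ H) js ≡ polyMul (eCoeff k G) (eCoeff k H) js
  eCoeff-⊗ G H js = begin
    eCoeff k (G ⊗ H) js
      ≡⟨ eCoeff-∑ k (G ⊗ H) js ⟩
    ℤ∑.∑[ z ∈ G ⊗ H ] coeff js z
      ≡⟨ ℤ∑.∑-concatMap _ G (coeff js) ⟩
    ℤ∑.∑[ x ∈ G ] ℤ∑.∑[ z ∈ map _ H ] coeff js z
      ≡⟨ ℤ∑.∑-cong G (λ x → ℤ∑.∑-map _ H (coeff js)) ⟩
    ℤ∑.∑[ (a , P) ∈ G ] ℤ∑.∑[ (b , Q) ∈ H ] coeff js (a ℤ.* b , P ++ Q)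
      ≡⟨ ℤ∑.∑-cong G (λ (a , P) → ℤ∑.∑-cong H (λ (b , Q) → coeff-++ js a b P Q)) ⟩
    ℤ∑.∑[ x ∈ G ] ℤ∑.∑[ y ∈ H ] ℤ∑.∑[ α ∈ below js ] coeff α x ℤ.* coeff (js′ α) y
      ≡⟨ ℤ∑.∑-cong G (λ x → ℤ∑.∑-swap H (below js) _) ⟩
    ℤ∑.∑[ x ∈ G ] ℤ∑.∑[ α ∈ below js ] ℤ∑.∑[ y ∈ H ] coeff α x ℤ.* coeff (js′ α) y
      ≡⟨ ℤ∑.∑-swap G (below js) _ ⟩
    ℤ∑.∑[ α ∈ below js ] ℤ∑.∑[ x ∈ G ] ℤ∑.∑[ y ∈ H ] coeff α x ℤ.* coeff (js′ α) y
      ≡⟨ ℤ∑.∑-cong (below js) (λ α → sym (ℤ∑.∑-*-∑ G H (coeff α) (coeff (js′ α)))) ⟩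
    ℤ∑.∑[ α ∈ below js ] (ℤ∑.∑[ x ∈ G ] coeff α x) ℤ.* (ℤ∑.∑[ y ∈ H ] coeff (js′ α) y)
      ≡⟨ ℤ∑.∑-cong (below js) (λ α → sym (cong₂ ℤ._*_ (eCoeff-∑ k G α) (eCoeff-∑ k H (js′ α)))) ⟩
    ℤ∑.∑[ α ∈ below js ] eCoeff k G α ℤ.* eCoeff k H (js′ α)
      ≡⟨ sym (polyMul-∑ (eCoeff k G) (eCoeff k H) js) ⟩
    polyMul (eCoeff k G) (eCoeff k H) js ∎
    where
    open ≡-Reasoning
    js′ = zipWith _∸_ js

  eCoeff-1 : ∀ (js : Vec ℕ k) → eCoeff k 1SR js ≡ polyOne js
  eCoeff-1 js = trans (ℤₚ.+-identityʳ _) (trans (ℤₚ.*-identityˡ _) (V-point js))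

dimBoundSR : SR → ℕ
dimBoundSR []            = 0
dimBoundSR ((a , P) ∷ G) = dimBound P ⊔ dimBoundSR G

eCoeff-tooLarge : ∀ k (G : SR) (js : Vec ℕ k) → Any (dimBoundSR G <_) js → eCoeff k G js ≡ 0ℤ
eCoeff-tooLarge k []            js large = refl
eCoeff-tooLarge k ((a , P) ∷ G) js large = cong₂ _+_
  (trans (cong (λ v → a ℤ.* + v) (V-tooLarge P js (Any.map (ℕₚ.≤-<-trans (ℕₚ.m≤m⊔n _ _)) large)))
         (ℤₚ.*-zeroʳ a))
  (eCoeff-tooLarge k G js (Any.map (ℕₚ.≤-<-trans (ℕₚ.m≤n⊔m _ _)) large))

eCoeff-polynomial : ∀ k (G : SR) → ∃[ N ] (∀ (js : Vec ℕ k) → N < totalDeg js → eCoeff k G js ≡ 0ℤ)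
eCoeff-polynomial k G =
  k * dimBoundSR G , λ js N<deg → eCoeff-tooLarge k G js (<totalDeg⇒Any< (dimBoundSR G) js N<deg)

mainTheorem11 : (k : ℕ) → 1 ≤ k →
    -- e_{G,k} is a polynomial (finitely many nonzero coefficients)
    (∀ (G : SR) → ∃[ N ] (∀ (js : Vec ℕ k) → N < totalDeg js → eCoeff k G js ≡ 0ℤ))
    × (∀ (G H : SR) (js : Vec ℕ k) → eCoeff k (G ⊕ H) js ≡ eCoeff k G js + eCoeff k H js)
    × (∀ (G : SR) (js : Vec ℕ k) → eCoeff k (⊖ G) js ≡ - eCoeff k G js)
    × (∀ (js : Vec ℕ k) → eCoeff k 0SR js ≡ 0ℤ)
    × (∀ (G H : SR) (js : Vec ℕ k) → eCoeff k (G ⊗ H) js ≡ polyMul (eCoeff k G) (eCoeff k H) js)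
    × (∀ (js : Vec ℕ k) → eCoeff k 1SR js ≡ polyOne js)
mainTheorem11 k _ =
  eCoeff-polynomial k , eCoeff-⊕ k , eCoeff-⊖ k , (λ js → refl) , eCoeff-⊗ k , eCoeff-1 k
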